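{- Let $p$ be an odd prime and $G$ a pro-$p$ compact $p$-adic Lie group containing a finite abelian normal subgroup $H$ with $G/H\cong\mathbb{Z}_p$, written $G=H\rtimes\Gamma$. Two elements $h_1\gamma^{a_1}$ and $h_2\gamma^{a_2}$ of $G$ ($h_1,h_2\in H$, $a_1,a_2\in\mathbb{Z}_p$) are conjugate if and only if (1) $a_1=a_2=:a$, and (2) if $a=0$ then there is $k\in\mathbb{Z}_p$ with $h_2=\gamma^kh_1\gamma^{ -k}$, while if $a\in p^i\mathbb{Z}_p\setminus p^{i+1}\mathbb{Z}_p$ then there is $k\in\{0,1,\dots,p^i-1\}$ with $h_2\gamma^kh_1^{ -1}\gamma^{ -k}\in(\gamma^{p^i}-1)H$.
   Context: $\Gamma=G/H\cong\mathbb{Z}_p$ with topological generator $\gamma$, identified with a lift in $G$ giving the splitting $G=H\rtimes\Gamma$. $(\gamma^{p^i}-1)H$ denotes the subgroup $\{\gamma^{p^i}h\gamma^{ -p^i}h^{ -1}:h\in H\}$ of the abelian group $H$ (the image of $\gamma^{p^i}-1$ acting on $H$ written additively). -}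

module Defs where

open import Level using (Level)
open import Algebra.Bundles using (AbelianGroup)
open import Data.Nat using (ℕ; zero; suc; _+_; _*_; _^_)
open import Data.Nat.Solver using (module +-*-Solver)
open import Data.Product using (Σ; ∃; ∃-syntax; _×_; _,_; proj₁; proj₂)
open import Relation.Binary.PropositionalEquality using (_≡_; refl; cong₂; module ≡-Reasoning)

_≋_[mod_] : ℕ → ℕ → ℕ → Set
a ≋ b [mod M ] = ∃[ s ] ∃[ t ] a + s * M ≡ b + t * M

-- The p-adic integers ℤₚ = lim ℤ/pⁿ, represented by coherent sequences of
-- representatives: seq n represents the image in ℤ/pⁿ.
record ℤₚ (p : ℕ) : Set where
  constructor mkℤₚ
  field
    seq : ℕ → ℕ
    coh : ∀ n → seq (suc n) ≋ seq n [mod p ^ n ]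
open ℤₚ public

private
  add-cong : ∀ {a b c d M} → a ≋ b [mod M ] → c ≋ d [mod M ] → (a + c) ≋ (b + d) [mod M ]
  add-cong {a} {b} {c} {d} {M} (s , t , e₁) (u , v , e₂) = s + u , t + v , eq
    where
      open +-*-Solver
      open ≡-Reasoning
      eq : a + c + (s + u) * M ≡ b + d + (t + v) * M
      eq = begin
        a + c + (s + u) * M
          ≡⟨ solve 5 (λ a c s u M → a :+ c :+ (s :+ u) :* M := (a :+ s :* M) :+ (c :+ u :* M)) refl a c s u M ⟩
        (a + s * M) + (c + u * M)
          ≡⟨ cong₂ _+_ e₁ e₂ ⟩
        (b + t * M) + (d + v * M)
          ≡⟨ solve 5 (λ b d t v M → (b :+ t :* M) :+ (d :+ v :* M) := b :+ d :+ (t :+ v) :* M) refl b d t v M ⟩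
        b + d + (t + v) * M ∎

module _ {p : ℕ} where
  _≈ₚ_ : ℤₚ p → ℤₚ p → Set
  x ≈ₚ y = ∀ n → seq x n ≋ seq y n [mod p ^ n ]

  0ₚ : ℤₚ p
  0ₚ = mkℤₚ (λ _ → 0) (λ n → 0 , 0 , refl)

  _+ₚ_ : ℤₚ p → ℤₚ p → ℤₚ p
  x +ₚ y = mkℤₚ (λ n → seq x n + seq y n) (λ n → add-cong (coh x n) (coh y n))

  _∈p^_ℤₚ : ℤₚ p → ℕ → Set
  x ∈p^ i ℤₚ = seq x i ≋ 0 [mod p ^ i ]

iter : ∀ {a} {A : Set a} → (A → A) → ℕ → A → A
iter f zero x = x
iter f (suc n) x = f (iter f n x)

-- The semidirect product G = H ⋊ ℤₚ, where the generator γ acts on H by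
-- conjugation through α (α h = γ h γ⁻¹), α^(p^m) = id.  The pair (h , a)
-- stands for the element h γᵃ.  γᵏ (k ∈ ℤₚ) acts by α^(k mod p^m), computed
-- from any representative of k mod p^m (well defined because α^(p^m) = id).
module SemiDirect {c ℓ} (p : ℕ) (H : AbelianGroup c ℓ) (α : AbelianGroup.Carrier H → AbelianGroup.Carrier H) (m : ℕ) where
  open AbelianGroup H

  act : ℤₚ p → Carrier → Carrier
  act k = iter α (seq k m)

  G : Set c
  G = Carrier × ℤₚ p

  -- (h₁ γ^a₁)(h₂ γ^a₂) = h₁ (γ^a₁ h₂ γ^-a₁) γ^(a₁+a₂)
  _·_ : G → G → G
  (h₁ , a₁) · (h₂ , a₂) = (h₁ ∙ act a₁ h₂) , (a₁ +ₚ a₂)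

  _≈G_ : G → G → Set ℓ
  (h₁ , a₁) ≈G (h₂ , a₂) = (h₁ ≈ h₂) × Lift′ (a₁ ≈ₚ a₂)
    where
      open import Level using (Lift)
      Lift′ : Set → Set ℓ
      Lift′ A = Lift ℓ A

  Conjugate : G → G → Set (c Level.⊔ ℓ)
  Conjugate x y = ∃[ g ] ((g · x) ≈G (y · g))

{-# OPTIONS --safe #-}
-- Conjugating h₁γᵃ by hγᵇ and comparing H-components shows that h₁γᵃ and h₂γᵃ are
-- conjugate iff h₂ · γᵇh₁⁻¹γ⁻ᵇ ∈ (γᵃ − 1)H for some b.  Since γ^(pᵐ) acts trivially,
-- (γᵃ − 1)H only depends on a mod pᵐ, and inverting a unit modulo pᵐ⁻ⁱ shows that it
-- equals (γ^(pⁱ) − 1)H when a has valuation i < m; as (γ^(q pⁱ) − 1)H ⊆ (γ^(pⁱ) − 1)H,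
-- b may then be reduced modulo pⁱ.  When pᵐ ∣ a the subgroup is trivial and the
-- condition says that h₂ lies in the γ-orbit of h₁.
module Submission where

open import Defs
open import Level using (_⊔_; lift)
open import Algebra.Bundles using (AbelianGroup)
open import Data.Nat using (ℕ; zero; suc; _+_; _*_; _^_; _∸_; _≤_; _<_; _≤?_; _%_; _/_; NonZero; s≤s⁻¹)
open import Data.Nat.Properties
  using (+-comm; +-assoc; +-identityʳ; +-suc; +-cancelˡ-≡; *-comm; ≤-total; <⇒≤; ≰⇒>; m≤n⇒∃[o]m+o≡n; m+[n∸m]≡n; ^-distribˡ-+-*; m^n≢0)
open import Data.Nat.Divisibility using (_∣_; divides; _∣?_; 1∣_; n∣m*n; ∣m+n∣m⇒∣n; *-monoˡ-∣; ∣-trans; ∣1⇒≡1)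
open import Data.Nat.DivMod using (m≡m%n+[m/n]*n; m%n<n)
open import Data.Nat.Coprimality using (Coprime; coprime-divisor; coprime-Bézout)
open import Data.Nat.GCD using (module Bézout)
open import Data.Nat.Primality using (Prime; prime⇒nonZero; prime⇒irreducible)
open import Data.Nat.Solver using (module +-*-Solver)
open import Data.Fin using (Fin; toℕ; fromℕ<; _≟_)
open import Data.Fin.Properties using (any?; toℕ-fromℕ<)
open import Data.Product using (∃-syntax; _×_; _,_)
open import Data.Sum using (_⊎_; inj₁; inj₂; [_,_])
open import Function.Base using (id; case_of_)
open import Function.Bundles using (_⇔_; mk⇔; Equivalence)
open import Relation.Binary using (Decidable)
open import Relation.Binary.Bundles using (Setoid)
open import Relation.Nullary using (¬_; Dec; yes; no; contradiction)
open import Relation.Nullary.Decidable using (map′; decidable-stable)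
open import Relation.Binary.PropositionalEquality as ≡ using (_≡_; _≢_)

≋-reflexive : ∀ {a b M} → a ≡ b → a ≋ b [mod M ]
≋-reflexive ≡.refl = 0 , 0 , ≡.refl

≋-refl : ∀ {a M} → a ≋ a [mod M ]
≋-refl = ≋-reflexive ≡.refl

≋-sym : ∀ {a b M} → a ≋ b [mod M ] → b ≋ a [mod M ]
≋-sym (s , t , e) = t , s , ≡.sym e

≋-trans : ∀ {a b c M} → a ≋ b [mod M ] → b ≋ c [mod M ] → a ≋ c [mod M ]
≋-trans {a} {b} {c} {M} (s , t , e₁) (u , v , e₂) = s + u , t + v , (begin
  a + (s + u) * M     ≡⟨ solve 4 (λ a s u M → a :+ (s :+ u) :* M := (a :+ s :* M) :+ u :* M) ≡.refl a s u M ⟩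
  a + s * M + u * M   ≡⟨ ≡.cong (_+ u * M) e₁ ⟩
  b + t * M + u * M   ≡⟨ solve 4 (λ b t u M → b :+ t :* M :+ u :* M := b :+ u :* M :+ t :* M) ≡.refl b t u M ⟩
  b + u * M + t * M   ≡⟨ ≡.cong (_+ t * M) e₂ ⟩
  c + v * M + t * M   ≡⟨ solve 4 (λ c v t M → c :+ v :* M :+ t :* M := c :+ (t :+ v) :* M) ≡.refl c v t M ⟩
  c + (t + v) * M     ∎)
  where
  open ≡.≡-Reasoning
  open +-*-Solver

≋-mod-divisor : ∀ {a b} M K → a ≋ b [mod M * K ] → a ≋ b [mod M ]
≋-mod-divisor {a} {b} M K (s , t , e) = s * K , t * K , (begin
  a + s * K * M     ≡⟨ ≡.cong (a +_) (reassoc s) ⟩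
  a + s * (M * K)   ≡⟨ e ⟩
  b + t * (M * K)   ≡⟨ ≡.cong (b +_) (reassoc t) ⟨
  b + t * K * M     ∎)
  where
  open ≡.≡-Reasoning
  open +-*-Solver
  reassoc : ∀ s → s * K * M ≡ s * (M * K)
  reassoc s = solve 3 (λ s K M → s :* K :* M := s :* (M :* K)) ≡.refl s K M

≋-+-cancelˡ : ∀ {b x y M} → (b + x) ≋ (b + y) [mod M ] → x ≋ y [mod M ]
≋-+-cancelˡ {b} {x} {y} (s , t , e) =
  s , t , +-cancelˡ-≡ b _ _ (≡.trans (≡.sym (+-assoc b x _)) (≡.trans e (+-assoc b y _)))

≋-+-congˡ : ∀ {b x y M} → x ≋ y [mod M ] → (b + x) ≋ (b + y) [mod M ]
≋-+-congˡ {b} {x} {y} (s , t , e) =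
  s , t , ≡.trans (+-assoc b x _) (≡.trans (≡.cong (b +_) e) (≡.sym (+-assoc b y _)))

≋0⇒∣ : ∀ {x M} → x ≋ 0 [mod M ] → M ∣ x
≋0⇒∣ {x} {M} (s , t , e) =
  ∣m+n∣m⇒∣n (≡.subst (M ∣_) (≡.trans (≡.sym e) (+-comm x _)) (n∣m*n t)) (n∣m*n s)

∣⇒≋0 : ∀ {x M} → M ∣ x → x ≋ 0 [mod M ]
∣⇒≋0 (divides c ≡.refl) = 0 , c , +-identityʳ _

≋-% : ∀ x M .{{_ : NonZero M}} → x ≋ x % M [mod M ]
≋-% x M = 0 , x / M , ≡.trans (+-identityʳ x) (m≡m%n+[m/n]*n x M)

^-monoʳ-∣ : ∀ p {m n} → m ≤ n → p ^ m ∣ p ^ n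
^-monoʳ-∣ p {m} m≤n with m≤n⇒∃[o]m+o≡n m≤n
... | d , ≡.refl = divides (p ^ d) (≡.trans (^-distribˡ-+-* p m d) (*-comm (p ^ m) (p ^ d)))

coprime-* : ∀ {u a b} → Coprime u a → Coprime u b → Coprime u (a * b)
coprime-* u⊥a u⊥b (d∣u , d∣ab) = u⊥b (d∣u , coprime-divisor d⊥a d∣ab)
  where
  d⊥a : Coprime _ _
  d⊥a (e∣d , e∣a) = u⊥a (∣-trans e∣d d∣u , e∣a)

coprime-^ : ∀ {u p} → Coprime u p → ∀ K → Coprime u (p ^ K)
coprime-^ u⊥p zero    (_ , d∣1) = ∣1⇒≡1 d∣1
coprime-^ u⊥p (suc K) = coprime-* u⊥p (coprime-^ u⊥p K)

prime∤⇒coprime : ∀ {p u} → Prime p → ¬ p ∣ u → Coprime u p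
prime∤⇒coprime p-prime p∤u (d∣u , d∣p) =
  [ id , (λ { ≡.refl → contradiction d∣u p∤u }) ] (prime⇒irreducible p-prime d∣p)

±multiple-of-unit* : ∀ {u L n M} → Coprime u L → n * L ≡ M →
                     ∃[ a ] (n ≋ a * (u * n) [mod M ] ⊎ (n + a * (u * n)) ≋ 0 [mod M ])
±multiple-of-unit* {u} {L} {n} u⊥L ≡.refl with coprime-Bézout u⊥L
... | Bézout.+- a b eq = a , inj₁ (b , 0 , (begin
  n + b * (n * L)               ≡⟨ solve 3 (λ n b L → n :+ b :* (n :* L) := (con 1 :+ b :* L) :* n) ≡.refl n b L ⟩
  (1 + b * L) * n               ≡⟨ ≡.cong (_* n) eq ⟩
  a * u * n                     ≡⟨ solve 4 (λ n a L u → a :* u :* n := a :* (u :* n) :+ con 0 :* (n :* L)) ≡.refl n a L u ⟩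
  a * (u * n) + 0 * (n * L)     ∎))
  where
  open ≡.≡-Reasoning
  open +-*-Solver
... | Bézout.-+ a b eq = a , inj₂ (0 , b , (begin
  n + a * (u * n) + 0 * (n * L)
    ≡⟨ solve 4 (λ n a u L → n :+ a :* (u :* n) :+ con 0 :* (n :* L) := (con 1 :+ a :* u) :* n) ≡.refl n a u L ⟩
  (1 + a * u) * n               ≡⟨ ≡.cong (_* n) eq ⟩
  b * L * n                     ≡⟨ solve 3 (λ b L n → b :* L :* n := con 0 :+ b :* (n :* L)) ≡.refl b L n ⟩
  0 + b * (n * L)               ∎))
  where
  open ≡.≡-Reasoning
  open +-*-Solver

module _ {p : ℕ} where

  _HasValuation_ : ℤₚ p → ℕ → Set
  a HasValuation i = a ∈p^ i ℤₚ × ¬ a ∈p^ suc i ℤₚ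

  seq-≋ : ∀ (a : ℤₚ p) n d → seq a (n + d) ≋ seq a n [mod p ^ n ]
  seq-≋ a n zero = ≋-reflexive (≡.cong (seq a) (+-identityʳ n))
  seq-≋ a n (suc d) = ≋-trans step (seq-≋ a n d)
    where
    step : seq a (n + suc d) ≋ seq a (n + d) [mod p ^ n ]
    step rewrite +-suc n d = ≋-mod-divisor (p ^ n) (p ^ d)
      (≡.subst (λ M → seq a (suc (n + d)) ≋ seq a (n + d) [mod M ]) (^-distribˡ-+-* p n d) (coh a (n + d)))

  ∈p^⇒p^∣seq : ∀ (a : ℤₚ p) {i m} → i ≤ m → a ∈p^ i ℤₚ → p ^ i ∣ seq a m
  ∈p^⇒p^∣seq a {i} i≤m a∈ with m≤n⇒∃[o]m+o≡n i≤m
  ... | d , ≡.refl = ≋0⇒∣ (≋-trans (seq-≋ a i d) a∈)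

  p^∣seq⇒∈p^ : ∀ (a : ℤₚ p) {i m} → i ≤ m → p ^ i ∣ seq a m → a ∈p^ i ℤₚ
  p^∣seq⇒∈p^ a {i} i≤m ∣a with m≤n⇒∃[o]m+o≡n i≤m
  ... | d , ≡.refl = ≋-trans (≋-sym (seq-≋ a i d)) (∣⇒≋0 ∣a)

  ∈p^-mono : ∀ (a : ℤₚ p) {j n} → j ≤ n → a ∈p^ n ℤₚ → a ∈p^ j ℤₚ
  ∈p^-mono a j≤n a∈ = p^∣seq⇒∈p^ a j≤n (∣-trans (^-monoʳ-∣ p j≤n) (≋0⇒∣ a∈))

  ∈p^⇒seq-multiple : ∀ (a : ℤₚ p) {i} m → a ∈p^ i ℤₚ → ∃[ c ] (c * p ^ i) ≋ seq a m [mod p ^ m ]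
  ∈p^⇒seq-multiple a {i} m a∈ with ≤-total i m
  ... | inj₁ i≤m with ∈p^⇒p^∣seq a i≤m a∈
  ...   | divides c eq = c , ≋-reflexive (≡.sym eq)
  ∈p^⇒seq-multiple a {i} m a∈ | inj₂ m≤i with m≤n⇒∃[o]m+o≡n m≤i | ≋0⇒∣ a∈
  ... | d , ≡.refl | divides c eq = c , ≡.subst (λ x → x ≋ seq a m [mod p ^ m ]) eq (seq-≋ a m d)

  valuation⇒seq≡unit*p^ : ∀ (a : ℤₚ p) {i m} → suc i ≤ m → a HasValuation i →
                          ∃[ u ] (seq a m ≡ u * p ^ i × ¬ p ∣ u)
  valuation⇒seq≡unit*p^ a {i} {m} i<m (a∈ , a∉) with ∈p^⇒p^∣seq a (<⇒≤ i<m) a∈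
  ... | divides u eq = u , eq , λ p∣u → a∉ (p^∣seq⇒∈p^ a i<m (p^suc∣ p∣u))
    where
    p^suc∣ : p ∣ u → p ^ suc i ∣ seq a m
    p^suc∣ p∣u = ≡.subst (p ^ suc i ∣_) (≡.sym eq) (*-monoˡ-∣ (p ^ i) p∣u)

  valuation-≥ : ∀ (a : ℤₚ p) {i m} → a ∈p^ m ℤₚ → a HasValuation i → m ≤ i
  valuation-≥ a {i} {m} a∈ (_ , a∉) with suc i ≤? m
  ... | yes i<m = contradiction (∈p^-mono a i<m a∈) a∉
  ... | no i≮m = s≤s⁻¹ (≰⇒> i≮m)

  module _ .{{_ : NonZero p}} where

    ∈p^⊎valuation : ∀ (a : ℤₚ p) n → a ∈p^ n ℤₚ ⊎ ∃[ i ] a HasValuation i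
    ∈p^⊎valuation a zero = inj₁ (∣⇒≋0 (1∣ _))
    ∈p^⊎valuation a (suc n) with ∈p^⊎valuation a n
    ... | inj₂ v = inj₂ v
    ... | inj₁ a∈ with p ^ suc n ∣? seq a (suc n)
    ...   | yes ∣a = inj₁ (∣⇒≋0 ∣a)
    ...   | no ∤a = inj₂ (n , a∈ , λ a∈′ → ∤a (≋0⇒∣ a∈′))

    no-valuation⇒≈0 : ∀ (a : ℤₚ p) → (∀ i → ¬ a HasValuation i) → a ≈ₚ 0ₚ
    no-valuation⇒≈0 a ¬v n with ∈p^⊎valuation a n
    ... | inj₁ a∈ = a∈
    ... | inj₂ (i , v) = contradiction v (¬v i)

  ≈ₚ⇒+ₚ-conj : ∀ (a a′ b : ℤₚ p) → a ≈ₚ a′ → (b +ₚ a) ≈ₚ (a′ +ₚ b)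
  ≈ₚ⇒+ₚ-conj a a′ b a≈a′ n = ≋-trans (≋-+-congˡ (a≈a′ n)) (≋-reflexive (+-comm (seq b n) (seq a′ n)))

  +ₚ-conj⇒≈ₚ : ∀ (a a′ b : ℤₚ p) → (b +ₚ a) ≈ₚ (a′ +ₚ b) → a ≈ₚ a′
  +ₚ-conj⇒≈ₚ a a′ b conj n = ≋-+-cancelˡ (≋-trans (conj n) (≋-reflexive (+-comm (seq a′ n) (seq b n))))

  p^≋0 : ∀ {m i} → m ≤ i → (p ^ i) ≋ 0 [mod p ^ m ]
  p^≋0 m≤i = ∣⇒≋0 (^-monoʳ-∣ p m≤i)

module _ {c ℓ} (S : Setoid c ℓ) where

  open Setoid S

  enumerable⇒decidable : ∀ {n} (enum : Fin n → Carrier) → (∀ x → ∃[ i ] enum i ≈ x) →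
                         (∀ i j → enum i ≈ enum j → i ≡ j) → Decidable _≈_
  enumerable⇒decidable enum surj inj x y with surj x | surj y
  ... | i , eᵢ≈x | j , eⱼ≈y = map′ (λ i≡j → trans (sym eᵢ≈x) (trans (reflexive (≡.cong enum i≡j)) eⱼ≈y))
                                   (λ x≈y → inj i j (trans eᵢ≈x (trans x≈y (sym eⱼ≈y)))) (i ≟ j)

module CyclicAction {c ℓ} (H : AbelianGroup c ℓ) (α : AbelianGroup.Carrier H → AbelianGroup.Carrier H)
  (α-cong : ∀ {x y} → AbelianGroup._≈_ H x y → AbelianGroup._≈_ H (α x) (α y))
  (α-hom : ∀ x y → AbelianGroup._≈_ H (α (AbelianGroup._∙_ H x y)) (AbelianGroup._∙_ H (α x) (α y))) where

  open AbelianGroup H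

  open import Algebra.Properties.AbelianGroup H
  open import Algebra.Properties.CommutativeSemigroup commutativeSemigroup using (interchange)
  open import Relation.Binary.Reasoning.Setoid setoid

  σ : ℕ → Carrier → Carrier
  σ = iter α

  δ : ℕ → Carrier → Carrier
  δ n h = σ n h ∙ h ⁻¹

  -- δ n h = γⁿhγ⁻ⁿh⁻¹, so x ∈Im-δ n is x ∈ (γⁿ − 1)H; a record so that n is inferable.
  infix 4 _∈Im-δ_
  record _∈Im-δ_ (x : Carrier) (n : ℕ) : Set (c ⊔ ℓ) where
    constructor im
    field
      preimage : Carrier
      ≈δ       : x ≈ δ n preimage

  σ-+ : ∀ j k x → σ (j + k) x ≡ σ j (σ k x)
  σ-+ zero    k x = ≡.refl
  σ-+ (suc j) k x = ≡.cong α (σ-+ j k x)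

  σ-cong : ∀ k {x y} → x ≈ y → σ k x ≈ σ k y
  σ-cong zero    x≈y = x≈y
  σ-cong (suc k) x≈y = α-cong (σ-cong k x≈y)

  σ-∙ : ∀ k x y → σ k (x ∙ y) ≈ σ k x ∙ σ k y
  σ-∙ zero    x y = refl
  σ-∙ (suc k) x y = trans (α-cong (σ-∙ k x y)) (α-hom _ _)

  σ-ε : ∀ k → σ k ε ≈ ε
  σ-ε zero    = refl
  σ-ε (suc k) = trans (α-cong (σ-ε k)) α-ε
    where
    α-ε : α ε ≈ ε
    α-ε = identityˡ-unique (α ε) (α ε) (trans (sym (α-hom ε ε)) (α-cong (identityˡ ε)))

  σ-⁻¹ : ∀ k x → σ k (x ⁻¹) ≈ σ k x ⁻¹
  σ-⁻¹ k x = inverseˡ-unique (σ k (x ⁻¹)) (σ k x)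
    (trans (sym (σ-∙ k (x ⁻¹) x)) (trans (σ-cong k (inverseˡ x)) (σ-ε k)))

  ∙-⁻¹-swap : ∀ {a b c d} → a ∙ b ≈ c ∙ d → a ∙ d ⁻¹ ≈ c ∙ b ⁻¹
  ∙-⁻¹-swap {a} {b} {c} {d} ab≈cd = begin
    a ∙ d ⁻¹                 ≈⟨ identityʳ _ ⟨
    (a ∙ d ⁻¹) ∙ ε           ≈⟨ ∙-congˡ (inverseʳ b) ⟨
    (a ∙ d ⁻¹) ∙ (b ∙ b ⁻¹)  ≈⟨ interchange a (d ⁻¹) b (b ⁻¹) ⟩
    (a ∙ b) ∙ (d ⁻¹ ∙ b ⁻¹)  ≈⟨ ∙-cong ab≈cd (comm (d ⁻¹) (b ⁻¹)) ⟩
    (c ∙ d) ∙ (b ⁻¹ ∙ d ⁻¹)  ≈⟨ interchange c d (b ⁻¹) (d ⁻¹) ⟩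
    (c ∙ b ⁻¹) ∙ (d ∙ d ⁻¹)  ≈⟨ ∙-congˡ (inverseʳ d) ⟩
    (c ∙ b ⁻¹) ∙ ε           ≈⟨ identityʳ _ ⟩
    c ∙ b ⁻¹                 ∎

  //-telescope : ∀ a b d → a ∙ d ⁻¹ ≈ (a ∙ b ⁻¹) ∙ (b ∙ d ⁻¹)
  //-telescope a b d = begin
    a ∙ d ⁻¹                 ≈⟨ ∙-congʳ (identityʳ a) ⟨
    (a ∙ ε) ∙ d ⁻¹           ≈⟨ ∙-congʳ (∙-congˡ (inverseˡ b)) ⟨
    (a ∙ (b ⁻¹ ∙ b)) ∙ d ⁻¹  ≈⟨ ∙-congʳ (assoc a (b ⁻¹) b) ⟨
    ((a ∙ b ⁻¹) ∙ b) ∙ d ⁻¹  ≈⟨ assoc _ _ _ ⟩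
    (a ∙ b ⁻¹) ∙ (b ∙ d ⁻¹)  ∎

  δ-cong : ∀ n {g h} → g ≈ h → δ n g ≈ δ n h
  δ-cong n g≈h = ∙-cong (σ-cong n g≈h) (⁻¹-cong g≈h)

  δ-∙ : ∀ n g h → δ n (g ∙ h) ≈ δ n g ∙ δ n h
  δ-∙ n g h = begin
    σ n (g ∙ h) ∙ (g ∙ h) ⁻¹        ≈⟨ ∙-cong (σ-∙ n g h) (sym (⁻¹-∙-comm g h)) ⟩
    (σ n g ∙ σ n h) ∙ (g ⁻¹ ∙ h ⁻¹)  ≈⟨ interchange _ _ _ _ ⟩
    δ n g ∙ δ n h                    ∎

  δ-⁻¹ : ∀ n g → δ n (g ⁻¹) ≈ g ∙ σ n g ⁻¹
  δ-⁻¹ n g = begin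
    σ n (g ⁻¹) ∙ g ⁻¹ ⁻¹  ≈⟨ ∙-cong (σ-⁻¹ n g) (⁻¹-involutive g) ⟩
    σ n g ⁻¹ ∙ g          ≈⟨ comm _ _ ⟩
    g ∙ σ n g ⁻¹          ∎

  δ-+ : ∀ j k h → δ (j + k) h ≈ δ j (σ k h) ∙ δ k h
  δ-+ j k h = trans (∙-congʳ (reflexive (σ-+ j k h))) (//-telescope _ (σ k h) h)

  ∈Im-δ-resp : ∀ {n x y} → x ≈ y → x ∈Im-δ n → y ∈Im-δ n
  ∈Im-δ-resp x≈y (im h x≈δh) = im h (trans (sym x≈y) x≈δh)

  ε∈Im-δ : ∀ n → ε ∈Im-δ n
  ε∈Im-δ n = im ε (sym (trans (∙-cong (σ-ε n) ε⁻¹≈ε) (identityʳ ε)))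

  ∈Im-δ-∙ : ∀ {n x y} → x ∈Im-δ n → y ∈Im-δ n → x ∙ y ∈Im-δ n
  ∈Im-δ-∙ {n} (im g x≈δg) (im h y≈δh) = im (g ∙ h) (trans (∙-cong x≈δg y≈δh) (sym (δ-∙ n g h)))

  ∈Im-δ-⁻¹ : ∀ {n x} → x ∈Im-δ n → x ⁻¹ ∈Im-δ n
  ∈Im-δ-⁻¹ {n} (im h x≈δh) = im (h ⁻¹) (trans (⁻¹-cong x≈δh) (trans (⁻¹-anti-homo-// _ _) (sym (δ-⁻¹ n h))))

  ∈Im-δ-cancelʳ : ∀ {n x y} → x ∙ y ∈Im-δ n → y ∈Im-δ n → x ∈Im-δ n
  ∈Im-δ-cancelʳ {x = x} {y} xy∈ y∈ =
    ∈Im-δ-resp (sym (x≈z//y x y (x ∙ y) refl)) (∈Im-δ-∙ xy∈ (∈Im-δ-⁻¹ y∈))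

  δ-*∈Im-δ : ∀ n q h → δ (q * n) h ∈Im-δ n
  δ-*∈Im-δ n zero    h = ∈Im-δ-resp (sym (inverseʳ h)) (ε∈Im-δ n)
  δ-*∈Im-δ n (suc q) h =
    ∈Im-δ-resp (sym (δ-+ n (q * n) h)) (∈Im-δ-∙ (im (σ (q * n) h) refl) (δ-*∈Im-δ n q h))

  ∈Im-δ-* : ∀ {n x} q → x ∈Im-δ q * n → x ∈Im-δ n
  ∈Im-δ-* {n} q (im h x≈δh) = ∈Im-δ-resp (sym x≈δh) (δ-*∈Im-δ n q h)

  ∈Im-δ-% : ∀ {n x y} B .{{_ : NonZero n}} → x ∙ σ B y ∈Im-δ n → x ∙ σ (B % n) y ∈Im-δ n
  ∈Im-δ-% {n} {x} {y} B x∙σBy∈ = ∈Im-δ-cancelʳ (∈Im-δ-resp x∙σBy≈ x∙σBy∈) (δ-*∈Im-δ n (B / n) z)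
    where
    z : Carrier
    z = σ (B % n) y
    x∙σBy≈ : x ∙ σ B y ≈ (x ∙ z) ∙ δ (B / n * n) z
    x∙σBy≈ = begin
      x ∙ σ B y                        ≡⟨ ≡.cong (λ k → x ∙ σ k y) (≡.trans (m≡m%n+[m/n]*n B n) (+-comm (B % n) _)) ⟩
      x ∙ σ (B / n * n + B % n) y      ≡⟨ ≡.cong (x ∙_) (σ-+ (B / n * n) (B % n) y) ⟩
      x ∙ σ (B / n * n) z              ≈⟨ ∙-congˡ (xyx⁻¹≈y z _) ⟨
      x ∙ (z ∙ σ (B / n * n) z ∙ z ⁻¹) ≈⟨ ∙-congˡ (assoc _ _ _) ⟩
      x ∙ (z ∙ δ (B / n * n) z)        ≈⟨ assoc _ _ _ ⟨
      (x ∙ z) ∙ δ (B / n * n) z        ∎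

  x∙σᵏy⁻¹≈ε⇒x≈σᵏy : ∀ k {x y} → x ∙ σ k (y ⁻¹) ≈ ε → x ≈ σ k y
  x∙σᵏy⁻¹≈ε⇒x≈σᵏy k {x} {y} eq = x∙y⁻¹≈ε⇒x≈y x (σ k y) (trans (∙-congˡ (sym (σ-⁻¹ k y))) eq)

  x≈σᵏy⇒x∙σᵏy⁻¹≈ε : ∀ k {x y} → x ≈ σ k y → x ∙ σ k (y ⁻¹) ≈ ε
  x≈σᵏy⇒x∙σᵏy⁻¹≈ε k {x} {y} eq = trans (∙-congˡ (σ-⁻¹ k y)) (x≈y⇒x∙y⁻¹≈ε eq)

  module Periodic (M : ℕ) (σ-period : ∀ h → σ M h ≈ h) where

    σ-*M : ∀ q x → σ (q * M) x ≈ x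
    σ-*M zero    x = refl
    σ-*M (suc q) x = trans (reflexive (σ-+ M (q * M) x)) (trans (σ-period _) (σ-*M q x))

    σ-≋ : ∀ {a b} → a ≋ b [mod M ] → ∀ x → σ a x ≈ σ b x
    σ-≋ {a} {b} (s , t , e) x = begin
      σ a x            ≈⟨ σ-cong a (σ-*M s x) ⟨
      σ a (σ (s * M) x) ≡⟨ σ-+ a (s * M) x ⟨
      σ (a + s * M) x  ≡⟨ ≡.cong (λ k → σ k x) e ⟩
      σ (b + t * M) x  ≡⟨ σ-+ b (t * M) x ⟩
      σ b (σ (t * M) x) ≈⟨ σ-cong b (σ-*M t x) ⟩
      σ b x            ∎

    ∈Im-δ-≋ : ∀ {n n′ x} → n ≋ n′ [mod M ] → x ∈Im-δ n → x ∈Im-δ n′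
    ∈Im-δ-≋ n≋n′ (im h x≈δh) = im h (trans x≈δh (∙-congʳ (σ-≋ n≋n′ h)))

    ∈Im-δ-≋0 : ∀ {n x} → n ≋ 0 [mod M ] → x ∈Im-δ n → x ≈ ε
    ∈Im-δ-≋0 n≋0 x∈ with ∈Im-δ-≋ n≋0 x∈
    ... | im h x≈δ₀h = trans x≈δ₀h (inverseʳ h)

    ∈Im-δ-neg : ∀ {n n′ x} → (n + n′) ≋ 0 [mod M ] → x ∈Im-δ n → x ∈Im-δ n′
    ∈Im-δ-neg {n} {n′} n+n′≋0 (im g x≈δg) = im (σ n g ⁻¹) (begin
      _                       ≈⟨ x≈δg ⟩
      σ n g ∙ g ⁻¹            ≈⟨ ∙-congˡ (⁻¹-cong σn′σng≈g) ⟨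
      σ n g ∙ σ n′ (σ n g) ⁻¹ ≈⟨ δ-⁻¹ n′ (σ n g) ⟨
      δ n′ (σ n g ⁻¹)         ∎)
      where
      σn′σng≈g : σ n′ (σ n g) ≈ g
      σn′σng≈g = trans (reflexive (≡.sym (σ-+ n′ n g)))
        (σ-≋ (≋-trans (≋-reflexive (+-comm n′ n)) n+n′≋0) g)

    ∈Im-δ-unit : ∀ {u L n x} → Coprime u L → n * L ≡ M → x ∈Im-δ n → x ∈Im-δ u * n
    ∈Im-δ-unit u⊥L nL≡M x∈ with ±multiple-of-unit* u⊥L nL≡M
    ... | a , inj₁ n≋ = ∈Im-δ-* a (∈Im-δ-≋ n≋ x∈)
    ... | a , inj₂ n+≋0 = ∈Im-δ-* a (∈Im-δ-neg n+≋0 x∈)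

    σ-orbit? : Decidable _≈_ → .{{_ : NonZero M}} → ∀ x y → Dec (∃[ k ] y ≈ σ k x)
    σ-orbit? _≈?_ x y = map′ (λ (f , y≈σᶠx) → toℕ f , y≈σᶠx) reduce (any? (λ f → y ≈? σ (toℕ f) x))
      where
      reduce : ∃[ k ] y ≈ σ k x → ∃[ f ] y ≈ σ (toℕ {M} f) x
      reduce (k , y≈σᵏx) = fromℕ< k%M<M , (begin
        y                         ≈⟨ y≈σᵏx ⟩
        σ k x                     ≈⟨ σ-≋ (≋-% k M) x ⟩
        σ (k % M) x               ≡⟨ ≡.cong (λ j → σ j x) (toℕ-fromℕ< k%M<M) ⟨
        σ (toℕ (fromℕ< k%M<M)) x  ∎)
        where
        k%M<M : k % M < M
        k%M<M = m%n<n k M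

module Conjugacy {c ℓ} (p : ℕ) (p-prime : Prime p) (H : AbelianGroup c ℓ)
  (α : AbelianGroup.Carrier H → AbelianGroup.Carrier H)
  (α-cong : ∀ {x y} → AbelianGroup._≈_ H x y → AbelianGroup._≈_ H (α x) (α y))
  (α-hom : ∀ x y → AbelianGroup._≈_ H (α (AbelianGroup._∙_ H x y)) (AbelianGroup._∙_ H (α x) (α y)))
  (m : ℕ) (σ-period : ∀ h → AbelianGroup._≈_ H (iter α (p ^ m) h) h) where

  open AbelianGroup H

  open CyclicAction H α α-cong α-hom
  open Periodic (p ^ m) σ-period
  open SemiDirect p H α m using (act; Conjugate)
  open import Algebra.Properties.AbelianGroup H
  open import Relation.Binary.Reasoning.Setoid setoid

  instance
    p≢0 : NonZero p
    p≢0 = prime⇒nonZero p-prime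

  fromℕₚ : ℕ → ℤₚ p
  fromℕₚ k = mkℤₚ (λ _ → k) (λ _ → ≋-refl)

  conjugate⇔ : ∀ h₁ h₂ a₁ a₂ → Conjugate (h₁ , a₁) (h₂ , a₂) ⇔
               (a₁ ≈ₚ a₂ × ∃[ B ] h₂ ∙ σ B (h₁ ⁻¹) ∈Im-δ seq a₁ m)
  conjugate⇔ h₁ h₂ a₁ a₂ = mk⇔ to from
    where
    A₂ : ℕ
    A₂ = seq a₂ m

    to : Conjugate (h₁ , a₁) (h₂ , a₂) → a₁ ≈ₚ a₂ × ∃[ B ] h₂ ∙ σ B (h₁ ⁻¹) ∈Im-δ seq a₁ m
    to ((g , b) , g∙σᴮh₁≈ , lift conj) =
      a₁≈a₂ , B , ∈Im-δ-≋ (≋-sym (a₁≈a₂ m)) (im (g ⁻¹) (begin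
        h₂ ∙ σ B (h₁ ⁻¹)  ≈⟨ ∙-congˡ (σ-⁻¹ B h₁) ⟩
        h₂ ∙ σ B h₁ ⁻¹    ≈⟨ ∙-⁻¹-swap g∙σᴮh₁≈ ⟨
        g ∙ σ A₂ g ⁻¹     ≈⟨ δ-⁻¹ A₂ g ⟨
        δ A₂ (g ⁻¹)       ∎))
      where
      B : ℕ
      B = seq b m
      a₁≈a₂ : a₁ ≈ₚ a₂
      a₁≈a₂ = +ₚ-conj⇒≈ₚ a₁ a₂ b conj

    from : a₁ ≈ₚ a₂ × ∃[ B ] h₂ ∙ σ B (h₁ ⁻¹) ∈Im-δ seq a₁ m → Conjugate (h₁ , a₁) (h₂ , a₂)
    from (a₁≈a₂ , B , x∈) with ∈Im-δ-≋ (a₁≈a₂ m) x∈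
    ... | im h x≈δh = (h ⁻¹ , fromℕₚ B) , conj-eq , lift (≈ₚ⇒+ₚ-conj a₁ a₂ (fromℕₚ B) a₁≈a₂)
      where
      swapped : h ⁻¹ ∙ σ A₂ (h ⁻¹) ⁻¹ ≈ h₂ ∙ σ B h₁ ⁻¹
      swapped = begin
        h ⁻¹ ∙ σ A₂ (h ⁻¹) ⁻¹  ≈⟨ δ-⁻¹ A₂ (h ⁻¹) ⟨
        δ A₂ (h ⁻¹ ⁻¹)         ≈⟨ δ-cong A₂ (⁻¹-involutive h) ⟩
        δ A₂ h                 ≈⟨ x≈δh ⟨
        h₂ ∙ σ B (h₁ ⁻¹)       ≈⟨ ∙-congˡ (σ-⁻¹ B h₁) ⟩
        h₂ ∙ σ B h₁ ⁻¹         ∎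
      conj-eq : h ⁻¹ ∙ σ B h₁ ≈ h₂ ∙ σ A₂ (h ⁻¹)
      conj-eq = begin
        h ⁻¹ ∙ σ B h₁              ≈⟨ ∙-congˡ (⁻¹-involutive _) ⟨
        h ⁻¹ ∙ σ B h₁ ⁻¹ ⁻¹        ≈⟨ ∙-⁻¹-swap swapped ⟩
        h₂ ∙ σ A₂ (h ⁻¹) ⁻¹ ⁻¹     ≈⟨ ∙-congˡ (⁻¹-involutive _) ⟩
        h₂ ∙ σ A₂ (h ⁻¹)           ∎

  ∈Im-δ-p^ : ∀ (a : ℤₚ p) {i x} → a ∈p^ i ℤₚ → x ∈Im-δ seq a m → x ∈Im-δ p ^ i
  ∈Im-δ-p^ a a∈ x∈ with ∈p^⇒seq-multiple a m a∈
  ... | c , cpⁱ≋ = ∈Im-δ-* c (∈Im-δ-≋ (≋-sym cpⁱ≋) x∈)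

  ∈Im-δ-valuation : ∀ (a : ℤₚ p) {i x} → a HasValuation i → x ∈Im-δ p ^ i → x ∈Im-δ seq a m
  ∈Im-δ-valuation a {i} v x∈ with suc i ≤? m
  ... | no i≮m = ∈Im-δ-resp (sym (∈Im-δ-≋0 (p^≋0 (s≤s⁻¹ (≰⇒> i≮m))) x∈)) (ε∈Im-δ _)
  ... | yes i<m with valuation⇒seq≡unit*p^ a i<m v
  ...   | u , seqᵐ≡ , p∤u = ≡.subst (_ ∈Im-δ_) (≡.sym seqᵐ≡)
    (∈Im-δ-unit (coprime-^ (prime∤⇒coprime p-prime p∤u) (m ∸ i)) pⁱpᵐ⁻ⁱ≡pᵐ x∈)
    where
    pⁱpᵐ⁻ⁱ≡pᵐ : p ^ i * p ^ (m ∸ i) ≡ p ^ m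
    pⁱpᵐ⁻ⁱ≡pᵐ = ≡.trans (≡.sym (^-distribˡ-+-* p i (m ∸ i))) (≡.cong (p ^_) (m+[n∸m]≡n (<⇒≤ i<m)))

  reduced-twist : ∀ {h₁ h₂} (a : ℤₚ p) {i} B → a ∈p^ i ℤₚ → h₂ ∙ σ B (h₁ ⁻¹) ∈Im-δ seq a m →
                  ∃[ k ] (k < p ^ i × h₂ ∙ σ k (h₁ ⁻¹) ∈Im-δ p ^ i)
  reduced-twist a {i} B a∈ x∈ = B % p ^ i , m%n<n B (p ^ i) , ∈Im-δ-% B (∈Im-δ-p^ a a∈ x∈)
    where
    instance
      pⁱ≢0 : NonZero (p ^ i)
      pⁱ≢0 = m^n≢0 p i

  twist-from-conditions : Decidable _≈_ → ∀ h₁ h₂ (a : ℤₚ p) →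
    (a ≈ₚ 0ₚ → ∃[ k ] h₂ ≈ act k h₁) →
    (∀ i → a HasValuation i → ∃[ k ] (k < p ^ i × h₂ ∙ σ k (h₁ ⁻¹) ∈Im-δ p ^ i)) →
    ∃[ B ] h₂ ∙ σ B (h₁ ⁻¹) ∈Im-δ seq a m
  twist-from-conditions _≈?_ h₁ h₂ a orbit-if-0 twist-if-valuation with ∈p^⊎valuation a m
  ... | inj₂ (i , v) with twist-if-valuation i v
  ...   | k , _ , x∈ = k , ∈Im-δ-valuation a v x∈
  -- pᵐ ∣ a does not decide a ≈ₚ 0ₚ, but membership in the finite orbit is decidable,
  -- and refuting it forces a ≈ₚ 0ₚ.
  twist-from-conditions _≈?_ h₁ h₂ a orbit-if-0 twist-if-valuation | inj₁ a∈ =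
    orbit⇒twist (decidable-stable (σ-orbit? _≈?_ {{m^n≢0 p m}} h₁ h₂) ¬¬orbit)
    where
    orbit⇒twist : ∃[ k ] h₂ ≈ σ k h₁ → ∃[ B ] h₂ ∙ σ B (h₁ ⁻¹) ∈Im-δ seq a m
    orbit⇒twist (k , h₂≈) = k , ∈Im-δ-resp (sym (x≈σᵏy⇒x∙σᵏy⁻¹≈ε k h₂≈)) (ε∈Im-δ _)

    large-valuation⇒orbit : ∀ i → a HasValuation i → ∃[ k ] h₂ ≈ σ k h₁
    large-valuation⇒orbit i v with twist-if-valuation i v
    ... | k , _ , x∈ = k , x∙σᵏy⁻¹≈ε⇒x≈σᵏy k (∈Im-δ-≋0 (p^≋0 (valuation-≥ a a∈ v)) x∈)

    ¬¬orbit : ¬ ¬ (∃[ k ] h₂ ≈ σ k h₁)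
    ¬¬orbit ¬orbit with orbit-if-0 (no-valuation⇒≈0 a (λ i v → ¬orbit (large-valuation⇒orbit i v)))
    ... | k , h₂≈ = ¬orbit (seq k m , h₂≈)

lemma2p7 : ∀ {c ℓ} (p : ℕ) → Prime p → p ≢ 2 →
    (H : AbelianGroup c ℓ) → let open AbelianGroup H in
    (e : ℕ) (enum : Fin (p ^ e) → Carrier) →
    (∀ h → ∃[ i ] enum i ≈ h) → (∀ i j → enum i ≈ enum j → i ≡ j) →
    (α : Carrier → Carrier) → (∀ {x y} → x ≈ y → α x ≈ α y) →
    (∀ x y → α (x ∙ y) ≈ α x ∙ α y) →
    (m : ℕ) → (∀ h → iter α (p ^ m) h ≈ h) →
    (h₁ h₂ : Carrier) (a₁ a₂ : ℤₚ p) →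
    SemiDirect.Conjugate p H α m (h₁ , a₁) (h₂ , a₂)
      ⇔ ((a₁ ≈ₚ a₂)
        × ((a₁ ≈ₚ 0ₚ → ∃[ k ] h₂ ≈ SemiDirect.act p H α m k h₁)
        × (∀ i → a₁ ∈p^ i ℤₚ → ¬ (a₁ ∈p^ suc i ℤₚ) →
             ∃[ k ] (k < p ^ i × ∃[ h ] (h₂ ∙ iter α k (h₁ ⁻¹) ≈ iter α (p ^ i) h ∙ h ⁻¹)))))
lemma2p7 p p-prime _ H _ enum surj inj α α-cong α-hom m σ-period h₁ h₂ a₁ a₂ = mk⇔
  (λ conj → case Equivalence.to (conjugate⇔ h₁ h₂ a₁ a₂) conj of λ where
    (a₁≈a₂ , B , x∈) →
      a₁≈a₂ ,
      (λ a₁≈0 → fromℕₚ B , x∙σᵏy⁻¹≈ε⇒x≈σᵏy B (∈Im-δ-≋0 (a₁≈0 m) x∈)) ,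
      λ i a₁∈ _ → case reduced-twist a₁ B a₁∈ x∈ of λ where
        (k , k<pⁱ , im h eq) → k , k<pⁱ , h , eq)
  (λ (a₁≈a₂ , orbit-if-0 , twist-if-valuation) →
    Equivalence.from (conjugate⇔ h₁ h₂ a₁ a₂) (a₁≈a₂ , twist-from-conditions
      (enumerable⇒decidable setoid enum surj inj) h₁ h₂ a₁ orbit-if-0
      λ i (a₁∈ , a₁∉) → case twist-if-valuation i a₁∈ a₁∉ of λ where
        (k , k<pⁱ , h , eq) → k , k<pⁱ , im h eq))
  where
  open AbelianGroup H
  open CyclicAction H α α-cong α-hom
  open Periodic (p ^ m) σ-period
  open Conjugacy p p-prime H α α-cong α-hom m σ-period
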